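{- Let $k\ge1$ and let $A$ be a $k\times k$ strictly upper triangular matrix of integers. Let $P_A$ be the set of integer sequences $\lambda=(\lambda_1,\ldots,\lambda_k)$ satisfying $\lambda_i \ge \sum_{j=i+1}^{k} A[i,j]\lambda_j$ for $1\le i\le k$, and let $P_A(n,k)$ be the set of elements of $P_A$ of weight $\lambda_1+\cdots+\lambda_k=n$. If every $\lambda\in P_A$ has all entries nonnegative, then \[\sum_{n=0}^{\infty}|P_A(n,k)|\,q^n=\prod_{i=1}^{k}\frac{1}{1-q^{b_i}},\] where $B=(I-A)^{ -1}$ and $b_i=\sum_{j} B[j,i]$ is the $i$-th column sum of $B$.
   Context: A strictly upper triangular matrix $A$ has $A[i,j]=0$ for $i\ge j$. $I$ is the $k\times k$ identity matrix. The weight of a sequence is the sum of its entries. -}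

module Defs where

open import Data.Nat as ℕ using (ℕ; zero; suc)
open import Data.Nat.Divisibility using (_∣?_)
open import Data.Integer as ℤ using (ℤ; +_)
open import Data.Fin using (Fin; toℕ; _<?_)
open import Data.Fin.Properties using ()
open import Data.Vec using (Vec; lookup)
open import Data.Bool using (if_then_else_)
open import Relation.Nullary.Decidable using (⌊_⌋; does)
open import Relation.Binary.PropositionalEquality using (_≡_)

Matrix : ℕ → Set
Matrix k = Fin k → Fin k → ℤ

Σℤ : ∀ {k} → (Fin k → ℤ) → ℤ
Σℤ {zero}  f = + 0
Σℤ {suc k} f = f Fin.zero ℤ.+ Σℤ (λ i → f (Fin.suc i))
  where import Data.Fin as Fin

Σℕ-to : ℕ → (ℕ → ℕ) → ℕ
Σℕ-to zero    f = f 0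
Σℕ-to (suc n) f = Σℕ-to n f ℕ.+ f (suc n)

StrictlyUpper : ∀ {k} → Matrix k → Set
StrictlyUpper {k} A = ∀ (i j : Fin k) → toℕ j ℕ.≤ toℕ i → A i j ≡ + 0

identity : ∀ {k} → Matrix k
identity i j = if does (i Data.Fin.≟ j) then + 1 else + 0
  where import Data.Fin

_⊝_ : ∀ {k} → Matrix k → Matrix k → Matrix k
(A ⊝ B) i j = A i j ℤ.- B i j

_⊗_ : ∀ {k} → Matrix k → Matrix k → Matrix k
(A ⊗ B) i j = Σℤ (λ l → A i l ℤ.* B l j)

IsInverse : ∀ {k} → Matrix k → Matrix k → Set
IsInverse {k} M B = (∀ i j → (M ⊗ B) i j ≡ identity i j)
                  × (∀ i j → (B ⊗ M) i j ≡ identity i j)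
  where open import Data.Product using (_×_)

colSum : ∀ {k} → Matrix k → Fin k → ℤ
colSum B j = Σℤ (λ i → B i j)

InPA : ∀ {k} → Matrix k → Vec ℤ k → Set
InPA {k} A v = ∀ (i : Fin k) →
  Σℤ (λ j → if does (i <? j) then A i j ℤ.* lookup v j else + 0) ℤ.≤ lookup v i

weight : ∀ {k} → Vec ℤ k → ℤ
weight v = Σℤ (lookup v)

Series : Set
Series = ℕ → ℕ

_⊛_ : Series → Series → Series
(f ⊛ g) n = Σℕ-to n (λ i → f i ℕ.* g (n ℕ.∸ i))

one : Series
one zero    = 1
one (suc _) = 0

∏ˢ : ∀ {k} → (Fin k → Series) → Series
∏ˢ {zero}  F = one
∏ˢ {suc k} F = F Fin.zero ⊛ ∏ˢ (λ i → F (Fin.suc i))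
  where import Data.Fin as Fin

-- 1/(1 - q^b) = Σ_m q^{m b}: coefficient of q^n is 1 iff b ∣ n  (intended for b ≥ 1)
geom : ℕ → Series
geom b n = if does (b ∣? n) then 1 else 0

module Submission where

-- With M = I − A, the inequalities defining P_A say exactly that M λ has nonnegative entries, so
-- λ ↦ M λ is a bijection from P_A onto ℕᵏ with inverse μ ↦ B μ, and the weight of B μ is
-- Σⱼ bⱼ μⱼ. The image under B of the j-th unit vector is the j-th column of B and lies in P_A, so
-- the hypothesis makes B nonnegative; no column of the invertible B vanishes, hence every bⱼ > 0.
-- The elements of P_A of weight n therefore correspond to the solutions μ ∈ ℕᵏ of
-- b₁ μ₁ + ⋯ + b_k μ_k = n, which are counted by the coefficient of qⁿ in ∏ⱼ 1/(1 − q^{bⱼ}).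

open import Defs

open import Data.Nat as ℕ using (ℕ; zero; suc; NonZero; _≤_)
import Data.Nat.Properties as ℕₚ
open import Data.Fin as Fin using (Fin; zero; suc; _<?_; _≟_; punchIn)
import Data.Fin.Properties as Finₚ
open import Data.Bool using (if_then_else_)
open import Data.Vec using (Vec; []; _∷_; lookup; tabulate)
open import Data.Vec.Properties using (∷-injectiveˡ; ∷-injectiveʳ; lookup∘tabulate; tabulate∘lookup; tabulate-cong)
open import Data.List using (List; []; _∷_; [_]; _++_; map; length)
open import Data.List.Properties using (length-++; length-map)
open import Data.List.Membership.Propositional using (_∈_)
open import Data.List.Membership.Propositional.Properties using (∈-map⁺; ∈-map⁻; ∈-++⁺ˡ; ∈-++⁺ʳ; ∈-++⁻)
open import Data.List.Relation.Unary.Any using (here)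
open import Data.List.Relation.Unary.All using ([])
open import Data.List.Relation.Unary.AllPairs using ([]; _∷_)
open import Data.List.Relation.Unary.Unique.Propositional using (Unique)
import Data.List.Relation.Unary.Unique.Propositional.Properties as Uniqueₚ
open import Data.Product using (Σ; Σ-syntax; ∃₂; _×_; _,_; proj₁; proj₂)
open import Data.Sum using (inj₁; inj₂)
open import Function using (_∘_; _⇔_; mk⇔; Equivalence)
open import Relation.Nullary using (Dec; yes; no; does; ¬_; contradiction)
open import Relation.Binary.PropositionalEquality hiding ([_])

module Solutions where

  open import Data.Nat using (_+_; _*_; _∸_; z≤n; s≤s)
  open import Data.Nat.Divisibility using (_∣_; _∣?_; divides)

  Σℕ-to-cong : ∀ n {f g : ℕ → ℕ} → (∀ i → f i ≡ g i) → Σℕ-to n f ≡ Σℕ-to n g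
  Σℕ-to-cong zero    f≗g = f≗g 0
  Σℕ-to-cong (suc n) f≗g = cong₂ _+_ (Σℕ-to-cong n f≗g) (f≗g (suc n))

  concatUpTo : {X : Set} → (ℕ → List X) → ℕ → List X
  concatUpTo f zero    = f 0
  concatUpTo f (suc n) = concatUpTo f n ++ f (suc n)

  length-concatUpTo : {X : Set} (f : ℕ → List X) (n : ℕ) → length (concatUpTo f n) ≡ Σℕ-to n (length ∘ f)
  length-concatUpTo f zero    = refl
  length-concatUpTo f (suc n) = trans (length-++ (concatUpTo f n)) (cong (_+ length (f (suc n))) (length-concatUpTo f n))

  ∈-concatUpTo⁺ : {X : Set} {x : X} (f : ℕ → List X) {i : ℕ} (n : ℕ) → i ≤ n → x ∈ f i → x ∈ concatUpTo f n
  ∈-concatUpTo⁺ f zero    z≤n x∈fi = x∈fi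
  ∈-concatUpTo⁺ f {i} (suc n) i≤1+n x∈fi with i ℕₚ.≟ suc n
  ... | yes refl = ∈-++⁺ʳ (concatUpTo f n) x∈fi
  ... | no i≢1+n = ∈-++⁺ˡ (∈-concatUpTo⁺ f n (ℕₚ.≤-pred (ℕₚ.≤∧≢⇒< i≤1+n i≢1+n)) x∈fi)

  ∈-concatUpTo⁻ : {X : Set} {x : X} (f : ℕ → List X) (n : ℕ) → x ∈ concatUpTo f n → Σ[ i ∈ ℕ ] i ≤ n × x ∈ f i
  ∈-concatUpTo⁻ f zero    x∈f0 = 0 , z≤n , x∈f0
  ∈-concatUpTo⁻ f (suc n) x∈ with ∈-++⁻ (concatUpTo f n) x∈
  ... | inj₁ x∈init = let i , i≤n , x∈fi = ∈-concatUpTo⁻ f n x∈init in i , ℕₚ.m≤n⇒m≤1+n i≤n , x∈fi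
  ... | inj₂ x∈last = suc n , ℕₚ.≤-refl , x∈last

  concatUpTo-unique : {X : Set} (f : ℕ → List X) → (∀ i → Unique (f i)) →
                      (∀ {x i j} → x ∈ f i → x ∈ f j → i ≡ j) → (n : ℕ) → Unique (concatUpTo f n)
  concatUpTo-unique f unique disjoint zero    = unique 0
  concatUpTo-unique f unique disjoint (suc n) =
    Uniqueₚ.++⁺ (concatUpTo-unique f unique disjoint n) (unique (suc n)) λ (x∈init , x∈last) →
      let i , i≤n , x∈fi = ∈-concatUpTo⁻ f n x∈init in
      ℕₚ.<-irrefl (disjoint x∈fi x∈last) (s≤s i≤n)

  prependQuotient : ∀ {k d i} → Dec (d ∣ i) → List (Vec ℕ k) → List (Vec ℕ (suc k))
  prependQuotient (yes (divides q _)) L = map (q ∷_) L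
  prependQuotient (no _)              L = []

  length-prependQuotient : ∀ {k d i} (d∣?i : Dec (d ∣ i)) (L : List (Vec ℕ k)) →
                           length (prependQuotient d∣?i L) ≡ (if does d∣?i then 1 else 0) * length L
  length-prependQuotient (yes (divides q _)) L = trans (length-map (q ∷_) L) (sym (ℕₚ.+-identityʳ (length L)))
  length-prependQuotient (no _)              L = refl

  ∈-prependQuotient⁻ : ∀ {k d i} {x : Vec ℕ (suc k)} (d∣?i : Dec (d ∣ i)) (L : List (Vec ℕ k)) →
                       x ∈ prependQuotient d∣?i L → ∃₂ λ q xs → x ≡ q ∷ xs × i ≡ d * q × xs ∈ L
  ∈-prependQuotient⁻ {d = d} (yes (divides q i≡q*d)) L x∈ with ∈-map⁻ (q ∷_) x∈
  ... | xs , xs∈L , refl = q , xs , refl , trans i≡q*d (ℕₚ.*-comm q d) , xs∈L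

  ∈-prependQuotient⁺ : ∀ {k d q} {xs : Vec ℕ k} .{{_ : NonZero d}} (d∣?dq : Dec (d ∣ d * q)) (L : List (Vec ℕ k)) →
                       xs ∈ L → q ∷ xs ∈ prependQuotient d∣?dq L
  ∈-prependQuotient⁺ {d = d} {q} (yes (divides q′ dq≡q′d)) L xs∈L
    rewrite ℕₚ.*-cancelˡ-≡ q q′ d (trans dq≡q′d (ℕₚ.*-comm q′ d)) = ∈-map⁺ (q′ ∷_) xs∈L
  ∈-prependQuotient⁺ {d = d} {q} (no d∤dq) L xs∈L = contradiction (divides q (ℕₚ.*-comm d q)) d∤dq

  prependQuotient-unique : ∀ {k d i} (d∣?i : Dec (d ∣ i)) {L : List (Vec ℕ k)} →
                           Unique L → Unique (prependQuotient d∣?i L)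
  prependQuotient-unique (yes _) unique = Uniqueₚ.map⁺ ∷-injectiveʳ unique
  prependQuotient-unique (no _)  unique = []

  infix 7 _⊙_

  _⊙_ : ∀ {k} → (Fin k → ℕ) → Vec ℕ k → ℕ
  b ⊙ []       = 0
  b ⊙ (x ∷ xs) = b zero * x + (b ∘ suc) ⊙ xs

  -- Block i of concatUpTo lists the solutions with b₀ μ₀ = i, so the lengths add up exactly
  -- as the coefficients in the Cauchy product _⊛_.
  solutions : ∀ k → (Fin k → ℕ) → ℕ → List (Vec ℕ k)
  solutions zero    b zero    = [ [] ]
  solutions zero    b (suc n) = []
  solutions (suc k) b n =
    concatUpTo (λ i → prependQuotient (b zero ∣? i) (solutions k (b ∘ suc) (n ∸ i))) n

  length-solutions : ∀ k (b : Fin k → ℕ) n → length (solutions k b n) ≡ ∏ˢ (geom ∘ b) n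
  length-solutions zero    b zero    = refl
  length-solutions zero    b (suc n) = refl
  length-solutions (suc k) b n = trans (length-concatUpTo _ n) (Σℕ-to-cong n λ i →
    trans (length-prependQuotient (b zero ∣? i) (solutions k (b ∘ suc) (n ∸ i)))
          (cong (geom (b zero) i *_) (length-solutions k (b ∘ suc) (n ∸ i))))

  ∈-solutions⁻ : ∀ k (b : Fin k → ℕ) n {μ} → μ ∈ solutions k b n → b ⊙ μ ≡ n
  ∈-solutions⁻ zero    b zero    {[]} _ = refl
  ∈-solutions⁻ zero    b (suc n) ()
  ∈-solutions⁻ (suc k) b n μ∈ with ∈-concatUpTo⁻ _ n μ∈
  ... | i , i≤n , μ∈blockᵢ with ∈-prependQuotient⁻ (b zero ∣? i) _ μ∈blockᵢ
  ... | q , xs , refl , i≡b₀q , xs∈ = begin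
    b zero * q + (b ∘ suc) ⊙ xs ≡⟨ cong₂ _+_ (sym i≡b₀q) (∈-solutions⁻ k (b ∘ suc) (n ∸ i) xs∈) ⟩
    i + (n ∸ i)                 ≡⟨ ℕₚ.m+[n∸m]≡n i≤n ⟩
    n                           ∎
    where open ≡-Reasoning

  ∈-solutions⁺ : ∀ k (b : Fin k → ℕ) → (∀ j → NonZero (b j)) → ∀ n {μ} → b ⊙ μ ≡ n → μ ∈ solutions k b n
  ∈-solutions⁺ zero    b b≢0 .0 {[]} refl = here refl
  ∈-solutions⁺ (suc k) b b≢0 .(b zero * q + (b ∘ suc) ⊙ xs) {q ∷ xs} refl =
    ∈-concatUpTo⁺ _ n (ℕₚ.m≤m+n (b zero * q) _)
      (∈-prependQuotient⁺ {{b≢0 zero}} (b zero ∣? b zero * q) _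
        (∈-solutions⁺ k (b ∘ suc) (b≢0 ∘ suc) _ (sym (ℕₚ.m+n∸m≡n (b zero * q) _))))
    where n = b zero * q + (b ∘ suc) ⊙ xs

  solutions-unique : ∀ k (b : Fin k → ℕ) n → Unique (solutions k b n)
  solutions-unique zero    b zero    = [] ∷ []
  solutions-unique zero    b (suc n) = []
  solutions-unique (suc k) b n = concatUpTo-unique _
    (λ i → prependQuotient-unique (b zero ∣? i) (solutions-unique k (b ∘ suc) (n ∸ i)))
    blocks-disjoint n
    where
    blocks-disjoint : ∀ {x i j} → x ∈ prependQuotient (b zero ∣? i) (solutions k (b ∘ suc) (n ∸ i)) →
                      x ∈ prependQuotient (b zero ∣? j) (solutions k (b ∘ suc) (n ∸ j)) → i ≡ j
    blocks-disjoint {i = i} {j} x∈blockᵢ x∈blockⱼ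
      with ∈-prependQuotient⁻ (b zero ∣? i) _ x∈blockᵢ | ∈-prependQuotient⁻ (b zero ∣? j) _ x∈blockⱼ
    ... | q , _ , refl , i≡b₀q , _ | q′ , _ , eq , j≡b₀q′ , _ =
      trans i≡b₀q (trans (cong (b zero *_) (∷-injectiveˡ eq)) (sym j≡b₀q′))

open import Data.Integer using (ℤ; +_; _+_; _*_; _-_; _<_; -1ℤ; ∣_∣)
import Data.Integer as ℤ
import Data.Integer.Properties as ℤₚ
open import Data.Integer.Tactic.RingSolver using (solve-∀)
open import Algebra.Properties.Semiring.Sum ℤₚ.+-*-semiring
  using (sum; sum-cong-≗; sum-remove; sum-replicate-zero; ∑-distrib-+; ∑-comm; *-distribˡ-sum; *-distribʳ-sum)

open Solutions using (_⊙_; solutions; length-solutions; ∈-solutions⁻; ∈-solutions⁺; solutions-unique)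

Σℤ≡sum : ∀ {k} (f : Fin k → ℤ) → Σℤ f ≡ sum f
Σℤ≡sum {zero}  f = refl
Σℤ≡sum {suc k} f = cong (_+_ (f zero)) (Σℤ≡sum (f ∘ suc))

sum-nonneg : ∀ {k} (f : Fin k → ℤ) → (∀ i → + 0 ℤ.≤ f i) → + 0 ℤ.≤ sum f
sum-nonneg {zero}  f f≥0 = ℤₚ.≤-refl
sum-nonneg {suc k} f f≥0 = ℤₚ.+-mono-≤ (f≥0 zero) (sum-nonneg (f ∘ suc) (f≥0 ∘ suc))

≤-sum : ∀ {k} (f : Fin k → ℤ) → (∀ i → + 0 ℤ.≤ f i) → ∀ i → f i ℤ.≤ sum f
≤-sum {suc k} f f≥0 i = begin
  f i                          ≡⟨ ℤₚ.+-identityʳ (f i) ⟨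
  f i + + 0                    ≤⟨ ℤₚ.+-monoʳ-≤ (f i) (sum-nonneg _ (f≥0 ∘ punchIn i)) ⟩
  f i + sum (f ∘ punchIn i)    ≡⟨ sum-remove f ⟨
  sum f                        ∎
  where open ℤₚ.≤-Reasoning

sum-single : ∀ {k} (f : Fin k → ℤ) i → (∀ j → j ≢ i → f j ≡ + 0) → sum f ≡ f i
sum-single {suc k} f i f≡0 = begin
  sum f                        ≡⟨ sum-remove f ⟩
  f i + sum (f ∘ punchIn i)    ≡⟨ cong (_+_ (f i)) (sum-cong-≗ (λ j → f≡0 _ (Finₚ.punchInᵢ≢i i j))) ⟩
  f i + sum {k} (λ _ → + 0)    ≡⟨ cong (_+_ (f i)) (sum-replicate-zero k) ⟩
  f i + + 0                    ≡⟨ ℤₚ.+-identityʳ (f i) ⟩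
  f i                          ∎
  where open ≡-Reasoning

identity-diag : ∀ {k} (i : Fin k) → identity i i ≡ + 1
identity-diag i with i ≟ i
... | yes _  = refl
... | no i≢i = contradiction refl i≢i

identity-off : ∀ {k} {i j : Fin k} → i ≢ j → identity i j ≡ + 0
identity-off {i = i} {j} i≢j with i ≟ j
... | yes i≡j = contradiction i≡j i≢j
... | no _    = refl

identity-nonneg : ∀ {k} (i j : Fin k) → + 0 ℤ.≤ identity i j
identity-nonneg i j with i ≟ j
... | yes _ = ℤ.+≤+ ℕ.z≤n
... | no _  = ℤₚ.≤-refl

infixr 7 _·_

_·_ : ∀ {k} → Matrix k → (Fin k → ℤ) → Fin k → ℤ
(M · x) i = sum (λ j → M i j * x j)

identity-· : ∀ {k} (x : Fin k → ℤ) → identity · x ≗ x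
identity-· x i = begin
  sum (λ j → identity i j * x j) ≡⟨ sum-single _ i (λ j j≢i → cong (_* x j) (identity-off (j≢i ∘ sym))) ⟩
  identity i i * x i             ≡⟨ cong (_* x i) (identity-diag i) ⟩
  + 1 * x i                      ≡⟨ ℤₚ.*-identityˡ (x i) ⟩
  x i                            ∎
  where open ≡-Reasoning

·-column : ∀ {k} (M : Matrix k) (j : Fin k) → M · (λ l → identity l j) ≗ λ i → M i j
·-column M j i = begin
  sum (λ l → M i l * identity l j) ≡⟨ sum-single _ j (λ l l≢j → trans (cong (M i l *_) (identity-off l≢j))
                                                                       (ℤₚ.*-zeroʳ (M i l))) ⟩
  M i j * identity j j             ≡⟨ cong (M i j *_) (identity-diag j) ⟩
  M i j * + 1                      ≡⟨ ℤₚ.*-identityʳ (M i j) ⟩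
  M i j                            ∎
  where open ≡-Reasoning

·-⊗ : ∀ {k} (M N : Matrix k) (x : Fin k → ℤ) → M · N · x ≗ (M ⊗ N) · x
·-⊗ M N x i = begin
  sum (λ l → M i l * sum (λ j → N l j * x j))   ≡⟨ sum-cong-≗ (λ l → *-distribˡ-sum (M i l) (λ j → N l j * x j)) ⟩
  sum (λ l → sum (λ j → M i l * (N l j * x j))) ≡⟨ ∑-comm (λ l j → M i l * (N l j * x j)) ⟩
  sum (λ j → sum (λ l → M i l * (N l j * x j))) ≡⟨ sum-cong-≗ (λ j → sum-cong-≗ (λ l → ℤₚ.*-assoc (M i l) (N l j) (x j))) ⟨
  sum (λ j → sum (λ l → M i l * N l j * x j))   ≡⟨ sum-cong-≗ (λ j → *-distribʳ-sum (x j) (λ l → M i l * N l j)) ⟨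
  sum (λ j → sum (λ l → M i l * N l j) * x j)   ≡⟨ sum-cong-≗ (λ j → cong (_* x j) (Σℤ≡sum (λ l → M i l * N l j))) ⟨
  ((M ⊗ N) · x) i                               ∎
  where open ≡-Reasoning

·-inverse : ∀ {k} (M N : Matrix k) → (∀ i j → (M ⊗ N) i j ≡ identity i j) →
            ∀ x → M · N · x ≗ x
·-inverse M N MN≡I x i = begin
  (M · N · x) i         ≡⟨ ·-⊗ M N x i ⟩
  ((M ⊗ N) · x) i       ≡⟨ sum-cong-≗ (λ j → cong (_* x j) (MN≡I i j)) ⟩
  (identity · x) i      ≡⟨ identity-· x i ⟩
  x i                   ∎
  where open ≡-Reasoning

·-⊝ : ∀ {k} (M N : Matrix k) (x : Fin k → ℤ) → (M ⊝ N) · x ≗ λ i → (M · x) i - (N · x) i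
-- The library distributes sums over scalar multiples only, so − N x is written as −1 · N x.
·-⊝ M N x i = begin
  sum (λ j → (M i j - N i j) * x j)             ≡⟨ sum-cong-≗ (λ j → split (M i j) (N i j) (x j)) ⟩
  sum (λ j → M i j * x j + -1ℤ * (N i j * x j)) ≡⟨ ∑-distrib-+ (λ j → M i j * x j) (λ j → -1ℤ * (N i j * x j)) ⟩
  (M · x) i + sum (λ j → -1ℤ * (N i j * x j))   ≡⟨ cong (_+_ ((M · x) i)) (*-distribˡ-sum -1ℤ (λ j → N i j * x j)) ⟨
  (M · x) i + -1ℤ * (N · x) i                   ≡⟨ cong (_+_ ((M · x) i)) (ℤₚ.-1*i≡-i ((N · x) i)) ⟩
  (M · x) i - (N · x) i                         ∎
  where
  open ≡-Reasoning
  split : ∀ a b c → (a - b) * c ≡ a * c + -1ℤ * (b * c)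
  split = solve-∀

sum-· : ∀ {k} (M : Matrix k) (x : Fin k → ℤ) → sum (M · x) ≡ sum (λ j → colSum M j * x j)
sum-· M x = begin
  sum (λ i → sum (λ j → M i j * x j)) ≡⟨ ∑-comm (λ i j → M i j * x j) ⟩
  sum (λ j → sum (λ i → M i j * x j)) ≡⟨ sum-cong-≗ (λ j → *-distribʳ-sum (x j) (λ i → M i j)) ⟨
  sum (λ j → sum (λ i → M i j) * x j) ≡⟨ sum-cong-≗ (λ j → cong (_* x j) (Σℤ≡sum (λ i → M i j))) ⟨
  sum (λ j → colSum M j * x j)        ∎
  where open ≡-Reasoning

module _ {k} {A : Matrix k} (upper : StrictlyUpper A) where

  ·-strictlyUpper : ∀ x i → (A · x) i ≡ Σℤ (λ j → if does (i <? j) then A i j * x j else + 0)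
  ·-strictlyUpper x i = trans (sum-cong-≗ (λ j → term (i <? j)))
                              (sym (Σℤ≡sum (λ j → if does (i <? j) then A i j * x j else + 0)))
    where
    term : ∀ {j} (i<?j : Dec (i Fin.< j)) → A i j * x j ≡ (if does i<?j then A i j * x j else + 0)
    term (yes _)  = refl
    term (no i≮j) = cong (_* _) (upper i _ (ℕₚ.≮⇒≥ i≮j))

  InPA⇔nonneg : ∀ v → InPA A v ⇔ (∀ i → + 0 ℤ.≤ ((identity ⊝ A) · lookup v) i)
  InPA⇔nonneg v = mk⇔ (λ v∈P i → subst (+ 0 ℤ.≤_) (sym (slack i)) (ℤₚ.i≤j⇒0≤j-i (v∈P i)))
                      (λ slack≥0 i → ℤₚ.0≤i-j⇒j≤i (subst (+ 0 ℤ.≤_) (slack i) (slack≥0 i)))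
    where
    slack : ∀ i → ((identity ⊝ A) · lookup v) i ≡ lookup v i - Σℤ (λ j → if does (i <? j) then A i j * lookup v j else + 0)
    slack i = trans (·-⊝ identity A (lookup v) i)
                    (cong₂ _-_ (identity-· (lookup v) i) (·-strictlyUpper (lookup v) i))

toℤ : ∀ {k} → Vec ℕ k → Fin k → ℤ
toℤ μ j = + lookup μ j

sum-⊙ : ∀ {k} (b : Fin k → ℕ) (μ : Vec ℕ k) → sum (λ j → + b j * toℤ μ j) ≡ + (b ⊙ μ)
sum-⊙ b []       = refl
sum-⊙ b (x ∷ μ) = begin
  + b zero * + x + sum (λ j → + b (suc j) * toℤ μ j) ≡⟨ cong₂ _+_ (sym (ℤₚ.pos-* (b zero) x)) (sum-⊙ (b ∘ suc) μ) ⟩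
  + (b zero ℕ.* x) + + ((b ∘ suc) ⊙ μ)              ≡⟨ ℤₚ.pos-+ (b zero ℕ.* x) ((b ∘ suc) ⊙ μ) ⟨
  + (b ⊙ (x ∷ μ))                                   ∎
  where open ≡-Reasoning

module Parametrisation {k} {A : Matrix k} (upper : StrictlyUpper A)
                       {B : Matrix k} (inv : IsInverse (identity ⊝ A) B) where

  private
    M : Matrix k
    M = identity ⊝ A

  M·tabulate-B· : ∀ x → M · lookup (tabulate (B · x)) ≗ x
  M·tabulate-B· x i = trans (sum-cong-≗ (λ j → cong (M i j *_) (lookup∘tabulate (B · x) j)))
                            (·-inverse M B (proj₁ inv) x i)

  B·nonneg∈PA : ∀ x → (∀ i → + 0 ℤ.≤ x i) → InPA A (tabulate (B · x))
  B·nonneg∈PA x x≥0 = Equivalence.from (InPA⇔nonneg upper (tabulate (B · x)))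
                          (λ i → subst (+ 0 ℤ.≤_) (sym (M·tabulate-B· x i)) (x≥0 i))

  toPA : Vec ℕ k → Vec ℤ k
  toPA μ = tabulate (B · toℤ μ)

  fromPA : Vec ℤ k → Vec ℕ k
  fromPA v = tabulate (λ i → ∣ (M · lookup v) i ∣)

  toPA∈PA : ∀ μ → InPA A (toPA μ)
  toPA∈PA μ = B·nonneg∈PA (toℤ μ) (λ _ → ℤ.+≤+ ℕ.z≤n)

  toPA-injective : ∀ {μ ν} → toPA μ ≡ toPA ν → μ ≡ ν
  toPA-injective {μ} {ν} eq = begin
    μ                  ≡⟨ tabulate∘lookup μ ⟨
    tabulate (lookup μ) ≡⟨ tabulate-cong (λ i → ℤₚ.+-injective (toℤ-eq i)) ⟩
    tabulate (lookup ν) ≡⟨ tabulate∘lookup ν ⟩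
    ν                  ∎
    where
    open ≡-Reasoning
    toℤ-eq : toℤ μ ≗ toℤ ν
    toℤ-eq i = trans (sym (M·tabulate-B· (toℤ μ) i))
                     (trans (cong (λ v → (M · lookup v) i) eq) (M·tabulate-B· (toℤ ν) i))

  toPA-fromPA : ∀ v → InPA A v → toPA (fromPA v) ≡ v
  toPA-fromPA v v∈P = begin
    tabulate (B · toℤ (fromPA v))  ≡⟨ tabulate-cong (λ i → sum-cong-≗ (λ j → cong (B i j *_) (toℤ-fromPA j))) ⟩
    tabulate (B · M · lookup v)    ≡⟨ tabulate-cong (·-inverse B M (proj₂ inv) (lookup v)) ⟩
    tabulate (lookup v)            ≡⟨ tabulate∘lookup v ⟩
    v                              ∎
    where
    open ≡-Reasoning
    toℤ-fromPA : toℤ (fromPA v) ≗ M · lookup v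
    toℤ-fromPA j = trans (cong +_ (lookup∘tabulate (λ i → ∣ (M · lookup v) i ∣) j))
                         (ℤₚ.0≤i⇒+∣i∣≡i (Equivalence.to (InPA⇔nonneg upper v) v∈P j))

  weight-toPA : ∀ μ → weight (toPA μ) ≡ sum (λ j → colSum B j * toℤ μ j)
  weight-toPA μ = begin
    Σℤ (lookup (toPA μ))   ≡⟨ Σℤ≡sum (lookup (toPA μ)) ⟩
    sum (lookup (toPA μ))  ≡⟨ sum-cong-≗ (lookup∘tabulate (B · toℤ μ)) ⟩
    sum (B · toℤ μ)        ≡⟨ sum-· B (toℤ μ) ⟩
    sum (λ j → colSum B j * toℤ μ j) ∎
    where open ≡-Reasoning

  module Nonnegative (P-nonneg : ∀ v → InPA A v → ∀ i → + 0 ℤ.≤ lookup v i) where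

    B-nonneg : ∀ i j → + 0 ℤ.≤ B i j
    B-nonneg i j = subst (+ 0 ℤ.≤_) (trans (lookup∘tabulate (B · eⱼ) i) (·-column B j i))
                         (P-nonneg (tabulate (B · eⱼ)) (B·nonneg∈PA eⱼ (λ l → identity-nonneg l j)) i)
      where
      eⱼ : Fin k → ℤ
      eⱼ l = identity l j

    column-nonzero : ∀ j → ¬ (∀ i → B i j ≡ + 0)
    column-nonzero j B·ⱼ≡0 = 1≢0 (begin
      + 1                               ≡⟨ identity-diag j ⟨
      identity j j                      ≡⟨ proj₁ inv j j ⟨
      Σℤ (λ l → M j l * B l j)          ≡⟨ Σℤ≡sum (λ l → M j l * B l j) ⟩
      sum (λ l → M j l * B l j)         ≡⟨ sum-cong-≗ (λ l → trans (cong (M j l *_) (B·ⱼ≡0 l)) (ℤₚ.*-zeroʳ (M j l))) ⟩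
      sum {k} (λ _ → + 0)               ≡⟨ sum-replicate-zero k ⟩
      + 0                               ∎)
      where
      open ≡-Reasoning
      1≢0 : + 1 ≢ + 0
      1≢0 ()

    colSum-positive : ∀ j → + 0 < colSum B j
    colSum-positive j with + 0 ℤ.<? colSum B j
    ... | yes 0<colSum = 0<colSum
    ... | no  0≮colSum = contradiction column-zero (column-nonzero j)
      where
      column-zero : ∀ i → B i j ≡ + 0
      column-zero i = ℤₚ.≤-antisym
        (ℤₚ.≤-trans (subst (B i j ℤ.≤_) (sym (Σℤ≡sum (λ l → B l j))) (≤-sum (λ l → B l j) (λ l → B-nonneg l j) i))
                    (ℤₚ.≮⇒≥ 0≮colSum))
        (B-nonneg i j)

    b : Fin k → ℕ
    b j = ∣ colSum B j ∣

    +b≡colSum : ∀ j → + b j ≡ colSum B j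
    +b≡colSum j = ℤₚ.0≤i⇒+∣i∣≡i (ℤₚ.<⇒≤ (colSum-positive j))

    b-nonzero : ∀ j → NonZero (b j)
    b-nonzero j = ℕ.>-nonZero (ℤₚ.drop‿+<+ (subst (+ 0 <_) (sym (+b≡colSum j)) (colSum-positive j)))

    weight-toPA-⊙ : ∀ μ → weight (toPA μ) ≡ + (b ⊙ μ)
    weight-toPA-⊙ μ = begin
      weight (toPA μ)                    ≡⟨ weight-toPA μ ⟩
      sum (λ j → colSum B j * toℤ μ j)   ≡⟨ sum-cong-≗ (λ j → cong (_* toℤ μ j) (+b≡colSum j)) ⟨
      sum (λ j → + b j * toℤ μ j)        ≡⟨ sum-⊙ b μ ⟩
      + (b ⊙ μ)                          ∎
      where open ≡-Reasoning

    ∈-toPA-solutions : ∀ n v → v ∈ map toPA (solutions k b n) ⇔ (InPA A v × weight v ≡ + n)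
    ∈-toPA-solutions n v = mk⇔ sound complete
      where
      sound : v ∈ map toPA (solutions k b n) → InPA A v × weight v ≡ + n
      sound v∈ with ∈-map⁻ toPA v∈
      ... | μ , μ∈ , refl = toPA∈PA μ , trans (weight-toPA-⊙ μ) (cong +_ (∈-solutions⁻ k b n μ∈))

      complete : InPA A v × weight v ≡ + n → v ∈ map toPA (solutions k b n)
      complete (v∈P , weight≡n) = subst (_∈ map toPA (solutions k b n)) (toPA-fromPA v v∈P)
        (∈-map⁺ toPA (∈-solutions⁺ k b b-nonzero n {fromPA v} (ℤₚ.+-injective (begin
          + (b ⊙ fromPA v)          ≡⟨ weight-toPA-⊙ (fromPA v) ⟨
          weight (toPA (fromPA v))  ≡⟨ cong weight (toPA-fromPA v v∈P) ⟩
          weight v                  ≡⟨ weight≡n ⟩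
          + n                       ∎))))
        where open ≡-Reasoning

theorem1 : (k : ℕ) → 1 ≤ k → (A : Matrix k) → StrictlyUpper A →
  (B : Matrix k) → IsInverse (identity ⊝ A) B →
  (∀ (v : Vec ℤ k) → InPA A v → ∀ (i : Fin k) → + 0 Data.Integer.≤ lookup v i) →
  (∀ (i : Fin k) → + 0 < colSum B i)
  × (∀ (n : ℕ) → Σ (List (Vec ℤ k)) (λ L →
       Unique L
       × (∀ (v : Vec ℤ k) → (v ∈ L) ⇔ (InPA A v × weight v ≡ + n))
       × length L ≡ ∏ˢ (λ i → geom ∣ colSum B i ∣) n))
theorem1 k _ A upper B inv P-nonneg = colSum-positive , λ n →
    map toPA (solutions k b n)
  , Uniqueₚ.map⁺ toPA-injective (solutions-unique k b n)
  , ∈-toPA-solutions n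
  , trans (length-map toPA (solutions k b n)) (length-solutions k b n)
  where
  open Parametrisation upper inv
  open Nonnegative P-nonneg
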